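{- For every positive integer $n$, $$t(1,1,1,7;n)=4N(1,1,1,7;4n+5)-2N(1,1,1,7;8n+10)$$ and $$t(1,7,7,7;n)=4N(1,7,7,7;4n+11)-2N(1,7,7,7;8n+22).$$
   Context: For positive integers $a_1,\dots,a_k$ and a nonnegative integer $n$, $N(a_1,\dots,a_k;n)$ is the number of $(x_1,\dots,x_k)\in\mathbb Z^k$ with $n=a_1x_1^2+\cdots+a_kx_k^2$, and $t(a_1,\dots,a_k;n)$ is the number of $(x_1,\dots,x_k)\in\mathbb Z^k$ with $n=a_1\frac{x_1(x_1-1)}2+\cdots+a_k\frac{x_k(x_k-1)}2$. -}

module Defs where

open import Data.Nat using (ℕ)
open import Data.Integer using (ℤ; +_; _+_; _*_; _-_)
open import Data.Product using (Σ; _×_)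
open import Data.Fin using (Fin)
open import Function.Bundles using (_↔_)
open import Relation.Binary.PropositionalEquality using (_≡_)

SolN : ℕ → ℕ → ℕ → ℕ → ℕ → Set
SolN a₁ a₂ a₃ a₄ n =
  Σ (ℤ × ℤ × ℤ × ℤ) λ { (x₁ , x₂ , x₃ , x₄) →
    + n ≡ + a₁ * (x₁ * x₁) + + a₂ * (x₂ * x₂) + + a₃ * (x₃ * x₃) + + a₄ * (x₄ * x₄) }
  where open import Data.Product using (_,_)

-- Solutions of n = Σ aᵢ xᵢ(xᵢ-1)/2 in ℤ⁴, written as 2n = Σ aᵢ xᵢ(xᵢ-1)
SolT : ℕ → ℕ → ℕ → ℕ → ℕ → Set
SolT a₁ a₂ a₃ a₄ n =
  Σ (ℤ × ℤ × ℤ × ℤ) λ { (x₁ , x₂ , x₃ , x₄) →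
    + 2 * + n ≡ + a₁ * (x₁ * (x₁ - + 1)) + + a₂ * (x₂ * (x₂ - + 1))
               + + a₃ * (x₃ * (x₃ - + 1)) + + a₄ * (x₄ * (x₄ - + 1)) }
  where open import Data.Product using (_,_)

HasCard : Set → ℕ → Set
HasCard S m = Fin m ↔ S

N≡ : ℕ → ℕ → ℕ → ℕ → ℕ → ℕ → Set
N≡ a₁ a₂ a₃ a₄ n m = HasCard (SolN a₁ a₂ a₃ a₄ n) m

t≡ : ℕ → ℕ → ℕ → ℕ → ℕ → ℕ → Set
t≡ a₁ a₂ a₃ a₄ n m = HasCard (SolT a₁ a₂ a₃ a₄ n) m

{-# OPTIONS --safe #-}
module Submission where

-- Each form is written in three ways as k (a² + b²) + (P² + 7R²), according to which
-- coordinate plays the role of P (for (1,1,1,7), with k = 1) or of R (for (1,7,7,7),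
-- with k = 7). Multiplying a + b i by 1 + i and P + R √-7 by (1 ± √-7)/2, all of norm 2,
-- maps the representations of m with P ≡ R (mod 2) bijectively onto the representations
-- of 2m satisfying explicit congruences mod 2 and mod 4. When 2m = 8n + Σ aᵢ, a computation
-- with residues mod 8 shows that every representation of m has P ≡ R (mod 2) for exactly
-- two of the three splittings, and that every representation of 2m satisfies the
-- congruences for exactly two of the six (splitting, sign) pairs, or for three when all its
-- coordinates are odd. The all-odd representations of 8n + Σ aᵢ are the vectors 2x - 1
-- with Σ aᵢ xᵢ(xᵢ - 1)/2 = n. Counting the pairs in two ways gives 4 N(m) = t(n) + 2 N(2m).

module Counting where

  open import Data.Bool using (Bool; true; false; T; if_then_else_)
  open import Data.Fin using (Fin; zero; suc)
  open import Data.Fin.Properties using (+↔⊎; *↔×; 0↔⊥; 1↔⊤; 2↔Bool; cantor-schröder-bernstein)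
  open import Data.Nat using (ℕ; zero; suc; _+_; _*_)
  open import Data.Product using (Σ; _×_; _,_)
  open import Data.Product.Function.Dependent.Propositional using (congˡ)
  open import Data.Product.Function.NonDependent.Propositional using (_×-↔_)
  open import Data.Sum using (_⊎_; inj₁; inj₂)
  open import Data.Sum.Function.Propositional using (_⊎-↔_)
  open import Function using (_∘_)
  open import Function.Bundles using (_↔_; mk↔ₛ′; Injection)
  open import Function.Properties.Inverse using (↔-refl; ↔-sym; ↔-trans; ↔⇒↣)
  open import Function.Related.Propositional using (K-reflexive; bijection; module EquationalReasoning)
  open import Function.Related.TypeIsomorphisms using (×-comm; ⊎-comm; ∃∃↔∃∃; Σ-distribˡ-⊎; Σ-assoc)
  open import Relation.Binary.PropositionalEquality using (_≡_; refl; sym; cong; cong₂)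

  bit : Bool → ℕ
  bit b = if b then 1 else 0

  count : ∀ {k} → (Fin k → Bool) → ℕ
  count {zero}  p = 0
  count {suc k} p = bit (p zero) + count (p ∘ suc)

  count-cong : ∀ {k} {p q : Fin k → Bool} → (∀ c → p c ≡ q c) → count p ≡ count q
  count-cong {zero}  eq = refl
  count-cong {suc k} eq = cong₂ _+_ (cong bit (eq zero)) (count-cong (eq ∘ suc))

  Fin↔Fin⇒≡ : ∀ {m n} → Fin m ↔ Fin n → m ≡ n
  Fin↔Fin⇒≡ e = cantor-schröder-bernstein (Injection.injective (↔⇒↣ e)) (Injection.injective (↔⇒↣ (↔-sym e)))

  T↔Fin-bit : ∀ b → T b ↔ Fin (bit b)
  T↔Fin-bit true  = ↔-sym 1↔⊤
  T↔Fin-bit false = ↔-sym 0↔⊥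

  Σ-Fin-suc↔⊎ : ∀ {k} {P : Fin (suc k) → Set} → Σ (Fin (suc k)) P ↔ (P zero ⊎ Σ (Fin k) (P ∘ suc))
  Σ-Fin-suc↔⊎ = mk↔ₛ′
    (λ { (zero , p) → inj₁ p ; (suc c , p) → inj₂ (c , p) })
    (λ { (inj₁ p) → zero , p ; (inj₂ (c , p)) → suc c , p })
    (λ { (inj₁ p) → refl ; (inj₂ (c , p)) → refl })
    (λ { (zero , p) → refl ; (suc c , p) → refl })

  Σ-Bool↔⊎ : {P : Bool → Set} → Σ Bool P ↔ (P false ⊎ P true)
  Σ-Bool↔⊎ = mk↔ₛ′
    (λ { (false , p) → inj₁ p ; (true , p) → inj₂ p })
    (λ { (inj₁ p) → false , p ; (inj₂ p) → true , p })
    (λ { (inj₁ p) → refl ; (inj₂ p) → refl })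
    (λ { (false , p) → refl ; (true , p) → refl })

  Σ-T↔Fin-count : ∀ {k} (p : Fin k → Bool) → Σ (Fin k) (T ∘ p) ↔ Fin (count p)
  Σ-T↔Fin-count {zero}  p = mk↔ₛ′ (λ ()) (λ ()) (λ ()) (λ ())
  Σ-T↔Fin-count {suc k} p =
    ↔-trans Σ-Fin-suc↔⊎ (↔-trans (T↔Fin-bit (p zero) ⊎-↔ Σ-T↔Fin-count (p ∘ suc)) (↔-sym +↔⊎))

  module _ {U V W : Set} {k : ℕ} (p : Fin k → U → Bool) (q : Bool → Fin k → V → Bool) (w : V → Bool)
    (p-count : ∀ u → count (λ c → p c u) ≡ 2)
    (q-count : ∀ v → count (λ c → q false c v) + count (λ c → q true c v) ≡ 2 + bit (w v))
    (fibre-↔ : ∀ σ c → Σ U (T ∘ p c) ↔ Σ V (T ∘ q σ c))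
    (marked-↔ : Σ V (T ∘ w) ↔ W)
    where

    open EquationalReasoning {k = bijection}

    double-count : (Bool × Fin 2 × U) ↔ (W ⊎ Fin 2 × V)
    double-count =
      (Bool × Fin 2 × U)
        ↔⟨ ↔-refl ×-↔ ×-comm (Fin 2) U ⟩
      (Bool × Σ U (λ u → Fin 2))
        ↔⟨ ↔-refl ×-↔ congˡ (λ {u} → K-reflexive (cong Fin (sym (p-count u)))) ⟩
      (Bool × Σ U (λ u → Fin (count (λ c → p c u))))
        ↔⟨ ↔-refl ×-↔ congˡ (λ {u} → ↔-sym (Σ-T↔Fin-count (λ c → p c u))) ⟩
      (Bool × Σ U (λ u → Σ (Fin k) (λ c → T (p c u))))
        ↔⟨ ↔-refl ×-↔ ∃∃↔∃∃ {A = U} {B = Fin k} (λ u c → T (p c u)) ⟩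
      Σ Bool (λ σ → Σ (Fin k) (λ c → Σ U (T ∘ p c)))
        ↔⟨ congˡ (λ {σ} → congˡ (λ {c} → fibre-↔ σ c)) ⟩
      Σ Bool (λ σ → Σ (Fin k) (λ c → Σ V (T ∘ q σ c)))
        ↔⟨ congˡ (λ {σ} → ∃∃↔∃∃ (λ c v → T (q σ c v))) ⟩
      Σ Bool (λ σ → Σ V (λ v → Σ (Fin k) (λ c → T (q σ c v))))
        ↔⟨ ∃∃↔∃∃ (λ σ v → Σ (Fin k) (λ c → T (q σ c v))) ⟩
      Σ V (λ v → Σ Bool (λ σ → Σ (Fin k) (λ c → T (q σ c v))))
        ↔⟨ congˡ (λ {v} → fibre v) ⟩
      Σ V (λ v → Fin 2 ⊎ T (w v))
        ↔⟨ Σ-distribˡ-⊎ ⟩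
      (Σ V (λ v → Fin 2) ⊎ Σ V (T ∘ w))
        ↔⟨ ⊎-comm _ _ ⟩
      (Σ V (T ∘ w) ⊎ Σ V (λ v → Fin 2))
        ↔⟨ marked-↔ ⊎-↔ ×-comm V (Fin 2) ⟩
      (W ⊎ Fin 2 × V) ∎
      where
      fibre : ∀ v → Σ Bool (λ σ → Σ (Fin k) (λ c → T (q σ c v))) ↔ (Fin 2 ⊎ T (w v))
      fibre v =
        Σ Bool (λ σ → Σ (Fin k) (λ c → T (q σ c v)))
          ↔⟨ Σ-Bool↔⊎ ⟩
        (Σ (Fin k) (λ c → T (q false c v)) ⊎ Σ (Fin k) (λ c → T (q true c v)))
          ↔⟨ Σ-T↔Fin-count _ ⊎-↔ Σ-T↔Fin-count _ ⟩
        (Fin (count (λ c → q false c v)) ⊎ Fin (count (λ c → q true c v)))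
          ↔⟨ ↔-sym +↔⊎ ⟩
        Fin (count (λ c → q false c v) + count (λ c → q true c v))
          ↔⟨ K-reflexive (cong Fin (q-count v)) ⟩
        Fin (2 + bit (w v))
          ↔⟨ +↔⊎ ⟩
        (Fin 2 ⊎ Fin (bit (w v)))
          ↔⟨ ↔-refl ⊎-↔ ↔-sym (T↔Fin-bit (w v)) ⟩
        (Fin 2 ⊎ T (w v)) ∎

    double-count-card : ∀ {a b t} → Fin a ↔ U → Fin b ↔ V → Fin t ↔ W → 4 * a ≡ t + 2 * b
    double-count-card {a} {b} {t} card-U card-V card-W = Fin↔Fin⇒≡ (
      Fin (4 * a)                 ↔⟨ *↔× ⟩
      (Fin 4 × Fin a)             ↔⟨ *↔× {2} ×-↔ card-U ⟩
      ((Fin 2 × Fin 2) × U)       ↔⟨ Σ-assoc ⟩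
      (Fin 2 × Fin 2 × U)         ↔⟨ 2↔Bool ×-↔ ↔-refl ⟩
      (Bool × Fin 2 × U)          ↔⟨ double-count ⟩
      (W ⊎ Fin 2 × V)             ↔⟨ ↔-sym card-W ⊎-↔ (↔-refl ×-↔ ↔-sym card-V) ⟩
      (Fin t ⊎ Fin 2 × Fin b)     ↔⟨ ↔-refl ⊎-↔ ↔-sym *↔× ⟩
      (Fin t ⊎ Fin (2 * b))       ↔⟨ ↔-sym +↔⊎ ⟩
      Fin (t + 2 * b)             ∎)

module Congruences where

  open import Data.Bool using (Bool; T)
  open import Data.Empty using (⊥; ⊥-elim)
  open import Data.Integer using (ℤ; +_; -[1+_]; _+_; _*_; -_; _-_; _%ℕ_; _/ℕ_)
  open import Data.Integer.DivMod using (a≡a%ℕn+[a/ℕn]*n; n%ℕd<d)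
  open import Data.Integer.Properties using (pos-+; pos-*; +-injective; +-identityˡ; *-cancelʳ-≡)
  open import Data.Integer.Tactic.RingSolver using (solve-∀)
  open import Data.Nat as ℕ using (ℕ; suc; NonZero; _≡ᵇ_)
  open import Data.Nat.DivMod using (m*n%n≡0)
  open import Data.Nat.Properties using (m≤m+n; m≤n+m; ≤-trans; <⇒≱; ≡ᵇ⇒≡; ≡⇒≡ᵇ)
  open import Relation.Binary.PropositionalEquality

  infix 4 _≡_mod_

  record _≡_mod_ (i j : ℤ) (d : ℕ) : Set where
    constructor congruent
    field
      quotient : ℤ
      equation : i ≡ j + quotient * + d

  module _ {d : ℕ} where

    ≡-mod-refl : ∀ {i} → i ≡ i mod d
    ≡-mod-refl {i} = congruent (+ 0) (lemma i (+ d))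
      where lemma : ∀ i d → i ≡ i + + 0 * d
            lemma = solve-∀

    +-cong-mod : ∀ {i i′ j j′} → i ≡ i′ mod d → j ≡ j′ mod d → i + j ≡ i′ + j′ mod d
    +-cong-mod {i′ = i′} {j′ = j′} (congruent k refl) (congruent l refl) = congruent (k + l) (lemma i′ j′ k l (+ d))
      where lemma : ∀ i j k l d → i + k * d + (j + l * d) ≡ i + j + (k + l) * d
            lemma = solve-∀

    *-cong-mod : ∀ {i i′ j j′} → i ≡ i′ mod d → j ≡ j′ mod d → i * j ≡ i′ * j′ mod d
    *-cong-mod {i′ = i′} {j′ = j′} (congruent k refl) (congruent l refl) =
      congruent (k * j′ + i′ * l + k * l * + d) (lemma i′ j′ k l (+ d))
      where lemma : ∀ i j k l d → (i + k * d) * (j + l * d) ≡ i * j + (k * j + i * l + k * l * d) * d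
            lemma = solve-∀

    neg-cong-mod : ∀ {i i′} → i ≡ i′ mod d → - i ≡ - i′ mod d
    neg-cong-mod {i′ = i′} (congruent k refl) = congruent (- k) (lemma i′ k (+ d))
      where lemma : ∀ i k d → - (i + k * d) ≡ - i + - k * d
            lemma = solve-∀

    sub-cong-mod : ∀ {i i′ j j′} → i ≡ i′ mod d → j ≡ j′ mod d → i - j ≡ i′ - j′ mod d
    sub-cong-mod p q = +-cong-mod p (neg-cong-mod q)

  ≡-mod-weaken : ∀ {i j} d e → i ≡ j mod (d ℕ.* e) → i ≡ j mod d
  ≡-mod-weaken {j = j} d e (congruent k refl) =
    congruent (k * + e) (trans (cong (λ de → j + k * de) (pos-* d e)) (lemma j k (+ d) (+ e)))
    where lemma : ∀ j k d e → j + k * (d * e) ≡ j + k * e * d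
          lemma = solve-∀

  private
    no-wraparound : ∀ {d r s} j → r ℕ.< d → + r ≡ + s + + suc j * + d → ⊥
    no-wraparound {d} {r} {s} j r<d eq = <⇒≱ r<d (subst (d ℕ.≤_) (sym r≡) (≤-trans (m≤m+n d (j ℕ.* d)) (m≤n+m _ s)))
      where r≡ : r ≡ s ℕ.+ (d ℕ.+ j ℕ.* d)
            r≡ = +-injective (trans eq (trans (cong (λ x → + s + x) (sym (pos-* (suc j) d))) (sym (pos-+ s _))))

    quotient-difference : ∀ r s a b d → r + a * d ≡ s + b * d → r ≡ s + (b - a) * d
    quotient-difference r s a b d eq = trans (lemma r a d) (trans (cong (_- a * d) eq) (lemma′ s b a d))
      where lemma : ∀ r a d → r ≡ r + a * d - a * d
            lemma = solve-∀
            lemma′ : ∀ s b a d → s + b * d - a * d ≡ s + (b - a) * d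
            lemma′ = solve-∀

  remainder-unique : ∀ {d r s} a b → r ℕ.< d → s ℕ.< d → + r + a * + d ≡ + s + b * + d → r ≡ s
  remainder-unique {d} {r} {s} a b r<d s<d eq with b - a | quotient-difference (+ r) (+ s) a b (+ d) eq
  ... | + 0      | r≡s = +-injective (trans r≡s (lemma (+ s) (+ d)))
    where lemma : ∀ s d → s + + 0 * d ≡ s
          lemma = solve-∀
  ... | + suc j  | r≡s = ⊥-elim (no-wraparound j r<d r≡s)
  ... | -[1+ j ] | r≡s = ⊥-elim (no-wraparound j s<d (trans (lemma (+ s) (+ suc j) (+ d)) (cong (_+ + suc j * + d) (sym r≡s))))
    where lemma : ∀ s k d → s ≡ s + (- k) * d + k * d
          lemma = solve-∀

  _∣ᵇ_ : (d : ℕ) .{{_ : NonZero d}} → ℤ → Bool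
  d ∣ᵇ i = i %ℕ d ≡ᵇ 0

  module _ (d : ℕ) .{{_ : NonZero d}} where

    ≡-mod-%ℕ : ∀ i → i ≡ + (i %ℕ d) mod d
    ≡-mod-%ℕ i = congruent (i /ℕ d) (a≡a%ℕn+[a/ℕn]*n i d)

    %ℕ-cong : ∀ {i j} → i ≡ j mod d → i %ℕ d ≡ j %ℕ d
    %ℕ-cong {i} {j} (congruent k eq) =
      remainder-unique (i /ℕ d) (j /ℕ d + k) (n%ℕd<d i d) (n%ℕd<d j d) (begin
        + (i %ℕ d) + i /ℕ d * + d           ≡⟨ sym (a≡a%ℕn+[a/ℕn]*n i d) ⟩
        i                                   ≡⟨ eq ⟩
        j + k * + d                         ≡⟨ cong (_+ k * + d) (a≡a%ℕn+[a/ℕn]*n j d) ⟩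
        + (j %ℕ d) + j /ℕ d * + d + k * + d ≡⟨ lemma (+ (j %ℕ d)) (j /ℕ d) k (+ d) ⟩
        + (j %ℕ d) + (j /ℕ d + k) * + d     ∎)
      where open ≡-Reasoning
            lemma : ∀ r q k d → r + q * d + k * d ≡ r + (q + k) * d
            lemma = solve-∀

    ∣ᵇ-cong : ∀ {i j} e → i ≡ j mod (d ℕ.* e) → d ∣ᵇ i ≡ d ∣ᵇ j
    ∣ᵇ-cong e p = cong (_≡ᵇ 0) (%ℕ-cong (≡-mod-weaken d e p))

    [k*d]%ℕd≡0 : ∀ k → (k * + d) %ℕ d ≡ 0
    [k*d]%ℕd≡0 k = trans (%ℕ-cong {j = + 0} (congruent k (lemma k (+ d)))) (m*n%n≡0 0 d)
      where lemma : ∀ k d → k * d ≡ + 0 + k * d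
            lemma = solve-∀

    ∣ᵇ-intro : ∀ {i} k → i ≡ k * + d → T (d ∣ᵇ i)
    ∣ᵇ-intro k refl = ≡⇒≡ᵇ _ 0 ([k*d]%ℕd≡0 k)

    i/ℕd*d≡i : ∀ i → T (d ∣ᵇ i) → i /ℕ d * + d ≡ i
    i/ℕd*d≡i i i%d≡0 = sym (trans (a≡a%ℕn+[a/ℕn]*n i d)
      (trans (cong (λ r → + r + i /ℕ d * + d) (≡ᵇ⇒≡ _ 0 i%d≡0)) (+-identityˡ _)))

    /ℕ-intro : ∀ {i} k → i ≡ k * + d → i /ℕ d ≡ k
    /ℕ-intro k refl = *-cancelʳ-≡ _ k (+ d) (i/ℕd*d≡i _ (∣ᵇ-intro k refl))

    ∣ᵇ-split : ∀ i j → T (d ∣ᵇ (i - j)) → i ≡ j + (i - j) /ℕ d * + d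
    ∣ᵇ-split i j t = trans (lemma i j) (cong (_+_ j) (sym (i/ℕd*d≡i (i - j) t)))
      where lemma : ∀ i j → i ≡ j + (i - j)
            lemma = solve-∀

module Representations where

  open import Algebra.Bundles using (AbelianGroup)
  open import Axiom.UniquenessOfIdentityProofs using (module Decidable⇒UIP)
  open import Data.Bool using (Bool; true; false; T; _∧_)
  open import Data.Bool.Properties using (T-irrelevant; T-∧)
  open import Data.Fin using (Fin; zero; suc)
  open import Data.Integer using (ℤ; +_; _+_; _*_; -_; _-_; _%ℕ_; _/ℕ_)
  open import Data.Integer.DivMod using (n%ℕd<d)
  open import Data.Integer.Properties using (_≟_; pos-+; pos-*; neg-involutive; *-cancelˡ-≡; +-0-abelianGroup)
  open import Data.Integer.Tactic.RingSolver using (solve-∀)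
  open import Data.Nat as ℕ using (ℕ; zero; suc; _≡ᵇ_; _%_)
  open import Data.Nat.DivMod using ([m+kn]%n≡m%n)
  open import Data.Nat.Properties using (≡ᵇ⇒≡; ≡⇒≡ᵇ; +-comm; *-comm; m<1+n⇒m<n∨m≡n)
  open import Data.Product using (Σ; _×_; _,_; proj₁; proj₂)
  open import Data.Product.Function.Dependent.Propositional using (Σ-↔)
  open import Data.Product.Properties using (Σ-≡,≡→≡)
  open import Data.Sum using (inj₁; inj₂)
  open import Data.Unit using (tt)
  open import Function using (_∘_)
  open import Function.Bundles using (_↔_; mk↔ₛ′; Equivalence; Inverse)
  open import Function.Properties.Inverse using (↔-sym; ↔-trans)
  open import Function.Related.Propositional using (K-reflexive; bijection; module EquationalReasoning)
  open import Function.Related.TypeIsomorphisms using (Σ-assoc)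
  open import Relation.Binary.PropositionalEquality
  open import Algebra.Properties.Group (AbelianGroup.group +-0-abelianGroup) using (∙-cancelʳ)
  open import Defs using (SolN; SolT; N≡; t≡)
  open Counting
  open Congruences

  _⁴ : Set → Set
  A ⁴ = A × A × A × A

  map⁴ : {A B : Set} → (A → B) → A ⁴ → B ⁴
  map⁴ f (x₁ , x₂ , x₃ , x₄) = f x₁ , f x₂ , f x₃ , f x₄

  ≡,≡,≡,≡→≡ : ∀ {A : Set} {x₁ x₂ x₃ x₄ y₁ y₂ y₃ y₄ : A} →
              x₁ ≡ y₁ → x₂ ≡ y₂ → x₃ ≡ y₃ → x₄ ≡ y₄ → (x₁ , x₂ , x₃ , x₄) ≡ (y₁ , y₂ , y₃ , y₄)
  ≡,≡,≡,≡→≡ refl refl refl refl = refl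

  ∧-intro : ∀ {x y} → T x → T y → T (x ∧ y)
  ∧-intro t u = Equivalence.from T-∧ (t , u)

  SolutionsWith : (ℤ ⁴ → ℤ) → ℤ → (ℤ ⁴ → Bool) → Set
  SolutionsWith Q h p = Σ (ℤ ⁴) λ v → h ≡ Q v × T (p v)

  subset-↔ : {A B : Set} {P : A → Set} {P′ : B → Set} →
             (∀ x (u v : P x) → u ≡ v) → (∀ y (u v : P′ y) → u ≡ v) →
             (f : A → B) (g : B → A) → (∀ x → P x → P′ (f x)) → (∀ y → P′ y → P (g y)) →
             (∀ x → P x → g (f x) ≡ x) → (∀ y → P′ y → f (g y) ≡ y) →
             Σ A P ↔ Σ B P′
  subset-↔ P-irr P′-irr f g f-P g-P gf fg = mk↔ₛ′
    (λ (x , p) → f x , f-P x p) (λ (y , p) → g y , g-P y p)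
    (λ (y , p) → Σ-≡,≡→≡ (fg y p , P′-irr y _ _)) (λ (x , p) → Σ-≡,≡→≡ (gf x p , P-irr x _ _))

  solution-irrelevant : ∀ (Q : ℤ ⁴ → ℤ) (h : ℤ) (p : ℤ ⁴ → Bool) v (s s′ : h ≡ Q v × T (p v)) → s ≡ s′
  solution-irrelevant Q h p v (e , t) (e′ , t′) =
    cong₂ _,_ (Decidable⇒UIP.≡-irrelevant _≟_ e e′) (T-irrelevant {p v} t t′)

  rearrange-↔ : ∀ {Q Q′ : ℤ ⁴ → ℤ} {h p} (π : ℤ ⁴ ↔ ℤ ⁴) → (∀ v → Q v ≡ Q′ (Inverse.to π v)) →
                SolutionsWith Q h (p ∘ Inverse.to π) ↔ SolutionsWith Q′ h p
  rearrange-↔ {h = h} {p} π Q≡Q′∘π =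
    Σ-↔ π (λ {v} → K-reflexive (cong (λ z → h ≡ z × T (p (Inverse.to π v))) (Q≡Q′∘π v)))

  -- Doubling on k (a² + b²) + P² + 7R²

  canonical : ℕ → ℤ ⁴ → ℤ
  canonical k (a , b , P , R) = + k * (a * a + b * b) + (P * P + + 7 * (R * R))

  sign : Bool → ℤ → ℤ
  sign false x = x
  sign true  x = - x

  sign-square : ∀ σ x → sign σ x * sign σ x ≡ x * x
  sign-square false x = refl
  sign-square true  x = lemma x
    where lemma : ∀ x → - x * - x ≡ x * x
          lemma = solve-∀

  canonical-sign : ∀ k σ a b P R → canonical k (a , b , P , sign σ R) ≡ canonical k (a , b , P , R)
  canonical-sign k σ a b P R = cong (λ s → + k * (a * a + b * b) + (P * P + + 7 * s)) (sign-square σ R)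

  sign-involutive : ∀ σ x → sign σ (sign σ x) ≡ x
  sign-involutive false x = refl
  sign-involutive true  x = neg-involutive x

  doublable : ℤ ⁴ → Bool
  doublable (_ , _ , P , R) = 2 ∣ᵇ (P - R)

  halvable : Bool → ℤ ⁴ → Bool
  halvable σ (A , B , P , R) = 2 ∣ᵇ (A - B) ∧ 4 ∣ᵇ (P - sign σ R)

  module Doubling (k : ℕ) (σ : Bool) where

    -- Up to the order of its parts, a + b i is multiplied by 1 + i and, writing P = R + 2d,
    -- P + R √-7 by (1 + √-7)/2, giving (d - 3R) + (R + d) √-7; σ conjugates the result.
    double⁴ : ℤ ⁴ → ℤ ⁴
    double⁴ (a , b , P , R) = a + b , a - b , d - + 3 * R , sign σ (R + d)
      where d = (P - R) /ℕ 2

    halve⁴ : ℤ ⁴ → ℤ ⁴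
    halve⁴ (A , B , P , R) = B + e , e , W * + 2 + f , - f
      where e = (A - B) /ℕ 2
            W = sign σ R
            f = (P - W) /ℕ 4

    halvable-double⁴ : ∀ v → T (halvable σ (double⁴ v))
    halvable-double⁴ (a , b , P , R) = ∧-intro
      (∣ᵇ-intro 2 b (lemma a b))
      (∣ᵇ-intro 4 (- R) (trans (cong (λ x → d - + 3 * R - x) (sign-involutive σ (R + d))) (lemma′ d R)))
      where d = (P - R) /ℕ 2
            lemma : ∀ a b → a + b - (a - b) ≡ b * + 2
            lemma = solve-∀
            lemma′ : ∀ d R → d - + 3 * R - (R + d) ≡ - R * + 4
            lemma′ = solve-∀

    doublable-halve⁴ : ∀ w → T (doublable (halve⁴ w))
    doublable-halve⁴ (A , B , P , R) = ∣ᵇ-intro 2 (W + f) (lemma W f)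
      where W = sign σ R
            f = (P - W) /ℕ 4
            lemma : ∀ W f → W * + 2 + f - - f ≡ (W + f) * + 2
            lemma = solve-∀

    canonical-double⁴ : ∀ v → T (doublable v) → canonical k (double⁴ v) ≡ + 2 * canonical k v
    canonical-double⁴ (a , b , P , R) t = begin
      canonical k (a + b , a - b , d - + 3 * R , sign σ (R + d))  ≡⟨ canonical-sign k σ (a + b) (a - b) (d - + 3 * R) (R + d) ⟩
      canonical k (a + b , a - b , d - + 3 * R , R + d)           ≡⟨ identity (+ k) a b R d ⟩
      + 2 * canonical k (a , b , R + d * + 2 , R)                 ≡⟨ cong (λ x → + 2 * canonical k (a , b , x , R)) (sym (∣ᵇ-split 2 P R t)) ⟩
      + 2 * canonical k (a , b , P , R)                           ∎
      where
      open ≡-Reasoning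
      d = (P - R) /ℕ 2
      identity : ∀ k a b R d →
        k * ((a + b) * (a + b) + (a - b) * (a - b)) + ((d - + 3 * R) * (d - + 3 * R) + + 7 * ((R + d) * (R + d)))
        ≡ + 2 * (k * (a * a + b * b) + ((R + d * + 2) * (R + d * + 2) + + 7 * (R * R)))
      identity = solve-∀

    canonical-halve⁴ : ∀ w → T (halvable σ w) → canonical k w ≡ + 2 * canonical k (halve⁴ w)
    canonical-halve⁴ (A , B , P , R) t = begin
      canonical k (A , B , P , R)                        ≡⟨ cong₂ (λ x y → canonical k (x , B , y , R)) (∣ᵇ-split 2 A B t₁) (∣ᵇ-split 4 P W t₂) ⟩
      canonical k (B + e * + 2 , B , W + f * + 4 , R)    ≡⟨ canonical-sign k σ (B + e * + 2) B (W + f * + 4) R ⟨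
      canonical k (B + e * + 2 , B , W + f * + 4 , W)    ≡⟨ identity (+ k) B e W f ⟩
      + 2 * canonical k (halve⁴ (A , B , P , R))         ∎
      where
      open ≡-Reasoning
      t₁ = proj₁ (Equivalence.to T-∧ t)
      t₂ = proj₂ (Equivalence.to T-∧ t)
      e = (A - B) /ℕ 2
      W = sign σ R
      f = (P - W) /ℕ 4
      identity : ∀ k B e W f →
        k * ((B + e * + 2) * (B + e * + 2) + B * B) + ((W + f * + 4) * (W + f * + 4) + + 7 * (W * W))
        ≡ + 2 * (k * ((B + e) * (B + e) + e * e) + ((W * + 2 + f) * (W * + 2 + f) + + 7 * (- f * - f)))
      identity = solve-∀

    halve⁴-double⁴ : ∀ v → T (doublable v) → halve⁴ (double⁴ v) ≡ v
    halve⁴-double⁴ (a , b , P , R) t = ≡,≡,≡,≡→≡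
      (trans (cong (_+_ (a - b)) e≡b) (lemma₁ a b))
      e≡b
      (trans (cong₂ (λ x y → x * + 2 + y) W≡R+d f≡-R) (trans (lemma₂ R d) (sym (∣ᵇ-split 2 P R t))))
      (trans (cong -_ f≡-R) (neg-involutive R))
      where
      d = (P - R) /ℕ 2
      W≡R+d : sign σ (sign σ (R + d)) ≡ R + d
      W≡R+d = sign-involutive σ (R + d)
      e≡b : (a + b - (a - b)) /ℕ 2 ≡ b
      e≡b = /ℕ-intro 2 b (lemma₃ a b)
        where lemma₃ : ∀ a b → a + b - (a - b) ≡ b * + 2
              lemma₃ = solve-∀
      f≡-R : (d - + 3 * R - sign σ (sign σ (R + d))) /ℕ 4 ≡ - R
      f≡-R = /ℕ-intro 4 (- R) (trans (cong (λ x → d - + 3 * R - x) W≡R+d) (lemma₄ d R))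
        where lemma₄ : ∀ d R → d - + 3 * R - (R + d) ≡ - R * + 4
              lemma₄ = solve-∀
      lemma₁ : ∀ a b → a - b + b ≡ a
      lemma₁ = solve-∀
      lemma₂ : ∀ R d → (R + d) * + 2 + - R ≡ R + d * + 2
      lemma₂ = solve-∀

    double⁴-halve⁴ : ∀ w → T (halvable σ w) → double⁴ (halve⁴ w) ≡ w
    double⁴-halve⁴ (A , B , P , R) t = ≡,≡,≡,≡→≡
      (trans (lemma₁ B e) (sym (∣ᵇ-split 2 A B t₁)))
      (lemma₂ B e)
      (trans (cong (λ x → x - + 3 * - f) d≡W+f) (trans (lemma₃ W f) (sym (∣ᵇ-split 4 P W t₂))))
      (trans (cong (λ x → sign σ (- f + x)) d≡W+f) (trans (cong (sign σ) (lemma₄ W f)) (sign-involutive σ R)))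
      where
      t₁ = proj₁ (Equivalence.to T-∧ t)
      t₂ = proj₂ (Equivalence.to T-∧ t)
      e = (A - B) /ℕ 2
      W = sign σ R
      f = (P - W) /ℕ 4
      d≡W+f : (W * + 2 + f - - f) /ℕ 2 ≡ W + f
      d≡W+f = /ℕ-intro 2 (W + f) (lemma W f)
        where lemma : ∀ W f → W * + 2 + f - - f ≡ (W + f) * + 2
              lemma = solve-∀
      lemma₁ : ∀ B e → B + e + e ≡ B + e * + 2
      lemma₁ = solve-∀
      lemma₂ : ∀ B e → B + e - e ≡ B
      lemma₂ = solve-∀
      lemma₃ : ∀ W f → W + f - + 3 * - f ≡ W + f * + 4
      lemma₃ = solve-∀
      lemma₄ : ∀ W f → - f + (W + f) ≡ W
      lemma₄ = solve-∀

    doubling-↔ : ∀ h → SolutionsWith (canonical k) h doublable ↔ SolutionsWith (canonical k) (+ 2 * h) (halvable σ)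
    doubling-↔ h = subset-↔
      (solution-irrelevant (canonical k) h doublable) (solution-irrelevant (canonical k) (+ 2 * h) (halvable σ))
      double⁴ halve⁴ doubled-solution halved-solution
      (λ v (_ , t) → halve⁴-double⁴ v t) (λ w (_ , t) → double⁴-halve⁴ w t)
      where
      doubled-solution : ∀ v → h ≡ canonical k v × T (doublable v) →
                         + 2 * h ≡ canonical k (double⁴ v) × T (halvable σ (double⁴ v))
      doubled-solution v (eq , t) = trans (cong (+ 2 *_) eq) (sym (canonical-double⁴ v t)) , halvable-double⁴ v
      halved-solution : ∀ w → + 2 * h ≡ canonical k w × T (halvable σ w) →
                        h ≡ canonical k (halve⁴ w) × T (doublable (halve⁴ w))
      halved-solution w (eq , t) = *-cancelˡ-≡ (+ 2) _ _ (trans eq (canonical-halve⁴ w t)) , doublable-halve⁴ w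

  -- Diagonal forms and their odd solutions

  diagonal : ℕ ⁴ → ℤ ⁴ → ℤ
  diagonal (a₁ , a₂ , a₃ , a₄) (x₁ , x₂ , x₃ , x₄) =
    + a₁ * (x₁ * x₁) + + a₂ * (x₂ * x₂) + + a₃ * (x₃ * x₃) + + a₄ * (x₄ * x₄)

  pronic : ℕ ⁴ → ℤ ⁴ → ℤ
  pronic (a₁ , a₂ , a₃ , a₄) (x₁ , x₂ , x₃ , x₄) =
    + a₁ * (x₁ * (x₁ - + 1)) + + a₂ * (x₂ * (x₂ - + 1)) + + a₃ * (x₃ * (x₃ - + 1)) + + a₄ * (x₄ * (x₄ - + 1))

  total : ℕ ⁴ → ℕ
  total (a₁ , a₂ , a₃ , a₄) = a₁ ℕ.+ a₂ ℕ.+ a₃ ℕ.+ a₄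

  odd : ℤ → Bool
  odd x = 2 ∣ᵇ (x + + 1)

  allOdd : ℤ ⁴ → Bool
  allOdd (x₁ , x₂ , x₃ , x₄) = odd x₁ ∧ odd x₂ ∧ odd x₃ ∧ odd x₄

  ∧⁴-elim : ∀ {b₁ b₂ b₃ b₄} → T (b₁ ∧ b₂ ∧ b₃ ∧ b₄) → T b₁ × T b₂ × T b₃ × T b₄
  ∧⁴-elim t with Equivalence.to T-∧ t
  ... | t₁ , t₂₃₄ with Equivalence.to T-∧ t₂₃₄
  ... | t₂ , t₃₄ = t₁ , t₂ , Equivalence.to T-∧ t₃₄

  toOdd : ℤ → ℤ
  toOdd x = x * + 2 - + 1

  fromOdd : ℤ → ℤ
  fromOdd X = (X + + 1) /ℕ 2

  toOdd-fromOdd : ∀ X → T (odd X) → toOdd (fromOdd X) ≡ X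
  toOdd-fromOdd X t = trans (cong (_- + 1) (i/ℕd*d≡i 2 (X + + 1) t)) (lemma X)
    where lemma : ∀ X → X + + 1 - + 1 ≡ X
          lemma = solve-∀

  fromOdd-toOdd : ∀ x → fromOdd (toOdd x) ≡ x
  fromOdd-toOdd x = /ℕ-intro 2 x (lemma x)
    where lemma : ∀ x → x * + 2 - + 1 + + 1 ≡ x * + 2
          lemma = solve-∀

  odd-toOdd : ∀ x → T (odd (toOdd x))
  odd-toOdd x = ∣ᵇ-intro 2 x (lemma x)
    where lemma : ∀ x → x * + 2 - + 1 + + 1 ≡ x * + 2
          lemma = solve-∀

  pos-total : ∀ a₁ a₂ a₃ a₄ → + total (a₁ , a₂ , a₃ , a₄) ≡ + a₁ + + a₂ + + a₃ + + a₄
  pos-total a₁ a₂ a₃ a₄ =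
    trans (pos-+ (a₁ ℕ.+ a₂ ℕ.+ a₃) a₄) (cong (_+ + a₄) (trans (pos-+ (a₁ ℕ.+ a₂) a₃) (cong (_+ + a₃) (pos-+ a₁ a₂))))

  diagonal-toOdd : ∀ a x → diagonal a (map⁴ toOdd x) ≡ + 4 * pronic a x + + total a
  diagonal-toOdd (a₁ , a₂ , a₃ , a₄) (x₁ , x₂ , x₃ , x₄) =
    trans (identity (+ a₁) (+ a₂) (+ a₃) (+ a₄) x₁ x₂ x₃ x₄)
          (cong (_+_ (+ 4 * pronic (a₁ , a₂ , a₃ , a₄) (x₁ , x₂ , x₃ , x₄))) (sym (pos-total a₁ a₂ a₃ a₄)))
    where
    identity : ∀ a₁ a₂ a₃ a₄ x₁ x₂ x₃ x₄ →
      a₁ * ((x₁ * + 2 - + 1) * (x₁ * + 2 - + 1)) + a₂ * ((x₂ * + 2 - + 1) * (x₂ * + 2 - + 1))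
      + a₃ * ((x₃ * + 2 - + 1) * (x₃ * + 2 - + 1)) + a₄ * ((x₄ * + 2 - + 1) * (x₄ * + 2 - + 1))
      ≡ + 4 * (a₁ * (x₁ * (x₁ - + 1)) + a₂ * (x₂ * (x₂ - + 1)) + a₃ * (x₃ * (x₃ - + 1)) + a₄ * (x₄ * (x₄ - + 1)))
        + (a₁ + a₂ + a₃ + a₄)
    identity = solve-∀

  module _ (a₁ a₂ a₃ a₄ n : ℕ) where

    private
      a = a₁ , a₂ , a₃ , a₄
      m = 8 ℕ.* n ℕ.+ total a

    pos-8n+total : + m ≡ + 4 * (+ 2 * + n) + + total a
    pos-8n+total = trans (pos-+ (8 ℕ.* n) (total a)) (cong (_+ + total a) (trans (pos-* 8 n) (lemma (+ n))))
      where lemma : ∀ n → + 8 * n ≡ + 4 * (+ 2 * n)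
            lemma = solve-∀

    toOdd-fromOdd⁴ : ∀ v → T (allOdd v) → map⁴ toOdd (map⁴ fromOdd v) ≡ v
    toOdd-fromOdd⁴ (X₁ , X₂ , X₃ , X₄) t with ∧⁴-elim t
    ... | t₁ , t₂ , t₃ , t₄ =
      ≡,≡,≡,≡→≡ (toOdd-fromOdd X₁ t₁) (toOdd-fromOdd X₂ t₂) (toOdd-fromOdd X₃ t₃) (toOdd-fromOdd X₄ t₄)

    allOdd-↔ : SolutionsWith (diagonal a) (+ m) allOdd ↔ SolT a₁ a₂ a₃ a₄ n
    allOdd-↔ = subset-↔ (solution-irrelevant (diagonal a) (+ m) allOdd) (λ _ → Decidable⇒UIP.≡-irrelevant _≟_)
      (map⁴ fromOdd) (map⁴ toOdd) fromOdd-solution toOdd-solution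
      (λ v (_ , t) → toOdd-fromOdd⁴ v t)
      (λ (x₁ , x₂ , x₃ , x₄) _ → ≡,≡,≡,≡→≡ (fromOdd-toOdd x₁) (fromOdd-toOdd x₂) (fromOdd-toOdd x₃) (fromOdd-toOdd x₄))
      where
      fromOdd-solution : ∀ v → + m ≡ diagonal a v × T (allOdd v) → + 2 * + n ≡ pronic a (map⁴ fromOdd v)
      fromOdd-solution v (eq , t) = *-cancelˡ-≡ (+ 4) _ _ (∙-cancelʳ (+ total a) _ _ (begin
        + 4 * (+ 2 * + n) + + total a                 ≡⟨ sym pos-8n+total ⟩
        + m                                           ≡⟨ eq ⟩
        diagonal a v                                  ≡⟨ cong (diagonal a) (sym (toOdd-fromOdd⁴ v t)) ⟩
        diagonal a (map⁴ toOdd (map⁴ fromOdd v))      ≡⟨ diagonal-toOdd a (map⁴ fromOdd v) ⟩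
        + 4 * pronic a (map⁴ fromOdd v) + + total a   ∎))
        where open ≡-Reasoning
      toOdd-solution : ∀ x → + 2 * + n ≡ pronic a x → + m ≡ diagonal a (map⁴ toOdd x) × T (allOdd (map⁴ toOdd x))
      toOdd-solution x@(x₁ , x₂ , x₃ , x₄) eq =
        trans pos-8n+total (trans (cong (λ y → + 4 * y + + total a) eq) (sym (diagonal-toOdd a x))) ,
        ∧-intro (odd-toOdd x₁) (∧-intro (odd-toOdd x₂) (∧-intro (odd-toOdd x₃) (odd-toOdd x₄)))

  -- Reduction mod 8

  residue : ℤ → ℤ
  residue x = + (x %ℕ 8)

  residues : ℤ ⁴ → ℤ ⁴
  residues v = map⁴ residue v

  ≡-mod-residue : ∀ x → x ≡ residue x mod 8
  ≡-mod-residue = ≡-mod-%ℕ 8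

  allBelow : ℕ → (ℕ → Bool) → Bool
  allBelow zero    f = true
  allBelow (suc n) f = f n ∧ allBelow n f

  allBelow-sound : ∀ {n} f → T (allBelow n f) → ∀ {r} → r ℕ.< n → T (f r)
  allBelow-sound {suc n} f t r<1+n with Equivalence.to T-∧ t | m<1+n⇒m<n∨m≡n r<1+n
  ... | t-n , _    | inj₂ refl = t-n
  ... | _ , t-rest | inj₁ r<n  = allBelow-sound f t-rest r<n

  everyResidue : (ℕ → Bool) → Bool
  everyResidue = allBelow 8

  everyResidue-sound : ∀ f → T (everyResidue f) → ∀ x → T (f (x %ℕ 8))
  everyResidue-sound f t x = allBelow-sound f t (n%ℕd<d x 8)

  every⁴ : (ℤ ⁴ → Bool) → Bool
  every⁴ f =
    everyResidue λ r₁ → everyResidue λ r₂ → everyResidue λ r₃ → everyResidue λ r₄ → f (+ r₁ , + r₂ , + r₃ , + r₄)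

  every⁴-sound : ∀ f → T (every⁴ f) → ∀ v → T (f (residues v))
  every⁴-sound f t (x₁ , x₂ , x₃ , x₄) =
    everyResidue-sound f₄ (everyResidue-sound f₃ (everyResidue-sound f₂ (everyResidue-sound f₁ t x₁) x₂) x₃) x₄
    where
    f₁ = λ r₁ → everyResidue λ r₂ → everyResidue λ r₃ → everyResidue λ r₄ → f (+ r₁ , + r₂ , + r₃ , + r₄)
    f₂ = λ r₂ → everyResidue λ r₃ → everyResidue λ r₄ → f (residue x₁ , + r₂ , + r₃ , + r₄)
    f₃ = λ r₃ → everyResidue λ r₄ → f (residue x₁ , residue x₂ , + r₃ , + r₄)
    f₄ = λ r₄ → f (residue x₁ , residue x₂ , residue x₃ , + r₄)

  _⇒ᵇ_ : Bool → Bool → Bool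
  false ⇒ᵇ _ = true
  true  ⇒ᵇ b = b

  ⇒ᵇ-mp : ∀ {b c} → T (b ⇒ᵇ c) → T b → T c
  ⇒ᵇ-mp {true} t _ = t

  sign-cong-mod : ∀ σ {d i j} → i ≡ j mod d → sign σ i ≡ sign σ j mod d
  sign-cong-mod false p = p
  sign-cong-mod true  p = neg-cong-mod p

  doublable-residues : ∀ v → doublable v ≡ doublable (residues v)
  doublable-residues (_ , _ , P , R) = ∣ᵇ-cong 2 4 (sub-cong-mod (≡-mod-residue P) (≡-mod-residue R))

  halvable-residues : ∀ σ v → halvable σ v ≡ halvable σ (residues v)
  halvable-residues σ (A , B , P , R) = cong₂ _∧_
    (∣ᵇ-cong 2 4 (sub-cong-mod (≡-mod-residue A) (≡-mod-residue B)))
    (∣ᵇ-cong 4 2 (sub-cong-mod (≡-mod-residue P) (sign-cong-mod σ (≡-mod-residue R))))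

  allOdd-residues : ∀ v → allOdd v ≡ allOdd (residues v)
  allOdd-residues (x₁ , x₂ , x₃ , x₄) =
    cong₂ _∧_ (odd-residue x₁) (cong₂ _∧_ (odd-residue x₂) (cong₂ _∧_ (odd-residue x₃) (odd-residue x₄)))
    where odd-residue : ∀ x → odd x ≡ odd (residue x)
          odd-residue x = ∣ᵇ-cong 2 4 (+-cong-mod (≡-mod-residue x) (≡-mod-refl {i = + 1}))

  diagonal-residues : ∀ a v → diagonal a v ≡ diagonal a (residues v) mod 8
  diagonal-residues (a₁ , a₂ , a₃ , a₄) (x₁ , x₂ , x₃ , x₄) =
    +-cong-mod (+-cong-mod (+-cong-mod (term a₁ x₁) (term a₂ x₂)) (term a₃ x₃)) (term a₄ x₄)
    where term : ∀ c x → + c * (x * x) ≡ + c * (residue x * residue x) mod 8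
          term c x = *-cong-mod (≡-mod-refl {i = + c}) (*-cong-mod (≡-mod-residue x) (≡-mod-residue x))

  -- Counting over three splittings

  record Splitting (a : ℕ ⁴) (k : ℕ) : Set where
    field
      rearrange          : Fin 3 → ℤ ⁴ ↔ ℤ ⁴
      diagonal-rearrange : ∀ c v → diagonal a v ≡ canonical k (Inverse.to (rearrange c) v)
      residues-rearrange : ∀ c v → residues (Inverse.to (rearrange c) v) ≡ Inverse.to (rearrange c) (residues v)

  module _ {a₁ a₂ a₃ a₄ k : ℕ} (S : Splitting (a₁ , a₂ , a₃ , a₄) k) where

    open Splitting S

    private
      a : ℕ ⁴
      a = a₁ , a₂ , a₃ , a₄

      π : Fin 3 → ℤ ⁴ → ℤ ⁴
      π c = Inverse.to (rearrange c)

    doublable-condition : ℤ ⁴ → Bool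
    doublable-condition r =
      ((+ 2 * diagonal a r) %ℕ 8 ≡ᵇ total a % 8) ⇒ᵇ (count (λ c → doublable (π c r)) ≡ᵇ 2)

    halvable-condition : ℤ ⁴ → Bool
    halvable-condition r =
      (diagonal a r %ℕ 8 ≡ᵇ total a % 8) ⇒ᵇ
      (count (λ c → halvable false (π c r)) ℕ.+ count (λ c → halvable true (π c r)) ≡ᵇ 2 ℕ.+ bit (allOdd r))

    -- Representations of m, resp. of 2m = 8n + total a, satisfy 2Q ≡ total a, resp.
    -- Q ≡ total a (mod 8); under these hypotheses the counts only depend on residues mod 8.
    LocalConditions : Set
    LocalConditions = T (every⁴ doublable-condition) × T (every⁴ halvable-condition)

    module _ (local : LocalConditions) (n m : ℕ) (m₂≡2m : 8 ℕ.* n ℕ.+ total a ≡ 2 ℕ.* m) where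

      private
        m₂ = 8 ℕ.* n ℕ.+ total a
        U = SolN a₁ a₂ a₃ a₄ m
        V = SolN a₁ a₂ a₃ a₄ m₂

      m₂%8 : m₂ % 8 ≡ total a % 8
      m₂%8 = trans (cong (_% 8) (trans (+-comm (8 ℕ.* n) (total a)) (cong (total a ℕ.+_) (*-comm 8 n))))
                   ([m+kn]%n≡m%n (total a) n 8)

      doublable-count : ∀ (u : U) → count (λ c → doublable (π c (proj₁ u))) ≡ 2
      doublable-count (v , eq) = begin
        count (λ c → doublable (π c v))             ≡⟨ count-cong at-residues ⟩
        count (λ c → doublable (π c (residues v)))  ≡⟨ ≡ᵇ⇒≡ _ 2 (⇒ᵇ-mp (every⁴-sound doublable-condition (proj₁ local) v) (≡⇒≡ᵇ _ _ residue-condition)) ⟩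
        2                                           ∎
        where
        open ≡-Reasoning
        at-residues : ∀ c → doublable (π c v) ≡ doublable (π c (residues v))
        at-residues c = trans (doublable-residues (π c v)) (cong doublable (residues-rearrange c v))
        residue-condition : (+ 2 * diagonal a (residues v)) %ℕ 8 ≡ total a % 8
        residue-condition = begin
          (+ 2 * diagonal a (residues v)) %ℕ 8 ≡⟨ sym (%ℕ-cong 8 (*-cong-mod (≡-mod-refl {i = + 2}) (diagonal-residues a v))) ⟩
          (+ 2 * diagonal a v) %ℕ 8            ≡⟨ cong (λ x → (+ 2 * x) %ℕ 8) (sym eq) ⟩
          (+ 2 * + m) %ℕ 8                     ≡⟨ cong (_%ℕ 8) (sym (pos-* 2 m)) ⟩
          (2 ℕ.* m) % 8                        ≡⟨ cong (_% 8) (sym m₂≡2m) ⟩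
          m₂ % 8                               ≡⟨ m₂%8 ⟩
          total a % 8                          ∎

      halvable-count : ∀ (v : V) →
        count (λ c → halvable false (π c (proj₁ v))) ℕ.+ count (λ c → halvable true (π c (proj₁ v))) ≡ 2 ℕ.+ bit (allOdd (proj₁ v))
      halvable-count (v , eq) = begin
        count (λ c → halvable false (π c v)) ℕ.+ count (λ c → halvable true (π c v))
          ≡⟨ cong₂ ℕ._+_ (count-cong (at-residues false)) (count-cong (at-residues true)) ⟩
        count (λ c → halvable false (π c (residues v))) ℕ.+ count (λ c → halvable true (π c (residues v)))
          ≡⟨ ≡ᵇ⇒≡ _ _ (⇒ᵇ-mp (every⁴-sound halvable-condition (proj₂ local) v) (≡⇒≡ᵇ _ _ residue-condition)) ⟩
        2 ℕ.+ bit (allOdd (residues v))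
          ≡⟨ cong (λ b → 2 ℕ.+ bit b) (sym (allOdd-residues v)) ⟩
        2 ℕ.+ bit (allOdd v) ∎
        where
        open ≡-Reasoning
        at-residues : ∀ σ c → halvable σ (π c v) ≡ halvable σ (π c (residues v))
        at-residues σ c = trans (halvable-residues σ (π c v)) (cong (halvable σ) (residues-rearrange c v))
        residue-condition : diagonal a (residues v) %ℕ 8 ≡ total a % 8
        residue-condition = trans (sym (%ℕ-cong 8 (diagonal-residues a v))) (trans (cong (_%ℕ 8) (sym eq)) m₂%8)

      fibre-↔ : ∀ σ c → Σ U (T ∘ doublable ∘ π c ∘ proj₁) ↔ Σ V (T ∘ halvable σ ∘ π c ∘ proj₁)
      fibre-↔ σ c =
        Σ U (T ∘ doublable ∘ π c ∘ proj₁)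
          ↔⟨ Σ-assoc ⟩
        SolutionsWith (diagonal a) (+ m) (doublable ∘ π c)
          ↔⟨ rearrange-↔ (rearrange c) (diagonal-rearrange c) ⟩
        SolutionsWith (canonical k) (+ m) doublable
          ↔⟨ Doubling.doubling-↔ k σ (+ m) ⟩
        SolutionsWith (canonical k) (+ 2 * + m) (halvable σ)
          ↔⟨ K-reflexive (cong (λ h → SolutionsWith (canonical k) h (halvable σ)) 2m≡m₂) ⟩
        SolutionsWith (canonical k) (+ m₂) (halvable σ)
          ↔⟨ ↔-sym (rearrange-↔ (rearrange c) (diagonal-rearrange c)) ⟩
        SolutionsWith (diagonal a) (+ m₂) (halvable σ ∘ π c)
          ↔⟨ ↔-sym Σ-assoc ⟩
        Σ V (T ∘ halvable σ ∘ π c ∘ proj₁) ∎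
        where
        open EquationalReasoning {k = bijection}
        2m≡m₂ : + 2 * + m ≡ + m₂
        2m≡m₂ = trans (sym (pos-* 2 m)) (cong +_ (sym m₂≡2m))

      Σ-allOdd-↔ : Σ V (T ∘ allOdd ∘ proj₁) ↔ SolT a₁ a₂ a₃ a₄ n
      Σ-allOdd-↔ = ↔-trans Σ-assoc (allOdd-↔ a₁ a₂ a₃ a₄ n)

      four-N≡t+two-N : ∀ {A t B} → N≡ a₁ a₂ a₃ a₄ m A → t≡ a₁ a₂ a₃ a₄ n t → N≡ a₁ a₂ a₃ a₄ m₂ B →
                       4 ℕ.* A ≡ t ℕ.+ 2 ℕ.* B
      four-N≡t+two-N card-U card-W card-V =
        double-count-card (λ c → doublable ∘ π c ∘ proj₁) (λ σ c → halvable σ ∘ π c ∘ proj₁) (allOdd ∘ proj₁)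
          doublable-count halvable-count fibre-↔ Σ-allOdd-↔ card-U card-V card-W

  -- The forms (1,1,1,7) and (1,7,7,7)

  splitting₁ : Splitting (1 , 1 , 1 , 7) 1
  splitting₁ = record
    { rearrange          = rearrange
    ; diagonal-rearrange = diagonal-rearrange
    ; residues-rearrange = λ { zero _ → refl ; (suc zero) _ → refl ; (suc (suc zero)) _ → refl }
    }
    where
    rearrange : Fin 3 → ℤ ⁴ ↔ ℤ ⁴
    rearrange zero =
      mk↔ₛ′ (λ (x₁ , x₂ , x₃ , x₄) → x₂ , x₃ , x₁ , x₄) (λ (a , b , P , R) → P , a , b , R) (λ _ → refl) (λ _ → refl)
    rearrange (suc zero) =
      mk↔ₛ′ (λ (x₁ , x₂ , x₃ , x₄) → x₁ , x₃ , x₂ , x₄) (λ (a , b , P , R) → a , P , b , R) (λ _ → refl) (λ _ → refl)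
    rearrange (suc (suc zero)) = mk↔ₛ′ (λ v → v) (λ v → v) (λ _ → refl) (λ _ → refl)
    diagonal-rearrange : ∀ c v → diagonal (1 , 1 , 1 , 7) v ≡ canonical 1 (Inverse.to (rearrange c) v)
    diagonal-rearrange zero (x₁ , x₂ , x₃ , x₄) = lemma (x₁ * x₁) (x₂ * x₂) (x₃ * x₃) (x₄ * x₄)
      where lemma : ∀ p q r s → + 1 * p + + 1 * q + + 1 * r + + 7 * s ≡ + 1 * (q + r) + (p + + 7 * s)
            lemma = solve-∀
    diagonal-rearrange (suc zero) (x₁ , x₂ , x₃ , x₄) = lemma (x₁ * x₁) (x₂ * x₂) (x₃ * x₃) (x₄ * x₄)
      where lemma : ∀ p q r s → + 1 * p + + 1 * q + + 1 * r + + 7 * s ≡ + 1 * (p + r) + (q + + 7 * s)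
            lemma = solve-∀
    diagonal-rearrange (suc (suc zero)) (x₁ , x₂ , x₃ , x₄) = lemma (x₁ * x₁) (x₂ * x₂) (x₃ * x₃) (x₄ * x₄)
      where lemma : ∀ p q r s → + 1 * p + + 1 * q + + 1 * r + + 7 * s ≡ + 1 * (p + q) + (r + + 7 * s)
            lemma = solve-∀

  -- Decided by evaluating both conditions on all 8⁴ residue vectors.
  local₁ : LocalConditions splitting₁
  local₁ = tt , tt

  splitting₂ : Splitting (1 , 7 , 7 , 7) 7
  splitting₂ = record
    { rearrange          = rearrange
    ; diagonal-rearrange = diagonal-rearrange
    ; residues-rearrange = λ { zero _ → refl ; (suc zero) _ → refl ; (suc (suc zero)) _ → refl }
    }
    where
    rearrange : Fin 3 → ℤ ⁴ ↔ ℤ ⁴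
    rearrange zero =
      mk↔ₛ′ (λ (x₁ , x₂ , x₃ , x₄) → x₃ , x₄ , x₁ , x₂) (λ (a , b , P , R) → P , R , a , b) (λ _ → refl) (λ _ → refl)
    rearrange (suc zero) =
      mk↔ₛ′ (λ (x₁ , x₂ , x₃ , x₄) → x₂ , x₄ , x₁ , x₃) (λ (a , b , P , R) → P , a , R , b) (λ _ → refl) (λ _ → refl)
    rearrange (suc (suc zero)) =
      mk↔ₛ′ (λ (x₁ , x₂ , x₃ , x₄) → x₂ , x₃ , x₁ , x₄) (λ (a , b , P , R) → P , a , b , R) (λ _ → refl) (λ _ → refl)
    diagonal-rearrange : ∀ c v → diagonal (1 , 7 , 7 , 7) v ≡ canonical 7 (Inverse.to (rearrange c) v)
    diagonal-rearrange zero (x₁ , x₂ , x₃ , x₄) = lemma (x₁ * x₁) (x₂ * x₂) (x₃ * x₃) (x₄ * x₄)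
      where lemma : ∀ p q r s → + 1 * p + + 7 * q + + 7 * r + + 7 * s ≡ + 7 * (r + s) + (p + + 7 * q)
            lemma = solve-∀
    diagonal-rearrange (suc zero) (x₁ , x₂ , x₃ , x₄) = lemma (x₁ * x₁) (x₂ * x₂) (x₃ * x₃) (x₄ * x₄)
      where lemma : ∀ p q r s → + 1 * p + + 7 * q + + 7 * r + + 7 * s ≡ + 7 * (q + s) + (p + + 7 * r)
            lemma = solve-∀
    diagonal-rearrange (suc (suc zero)) (x₁ , x₂ , x₃ , x₄) = lemma (x₁ * x₁) (x₂ * x₂) (x₃ * x₃) (x₄ * x₄)
      where lemma : ∀ p q r s → + 1 * p + + 7 * q + + 7 * r + + 7 * s ≡ + 7 * (q + r) + (p + + 7 * s)
            lemma = solve-∀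

  local₂ : LocalConditions splitting₂
  local₂ = tt , tt


import Data.Integer as ℤ
import Data.Integer.Properties as ℤ
open import Data.Integer.Tactic.RingSolver using (solve-∀)
import Data.Nat.Tactic.RingSolver as ℕ-Solver
open import Relation.Binary.PropositionalEquality using (sym; trans; cong; module ≡-Reasoning)
open Representations using (four-N≡t+two-N; splitting₁; local₁; splitting₂; local₂)

open import Defs
open import Data.Nat using (ℕ; _≥_; _+_; _*_)
open import Data.Integer using (+_) renaming (_*_ to _*ℤ_; _-_ to _-ℤ_)
open import Data.Product using (_×_; _,_)
open import Relation.Binary.PropositionalEquality using (_≡_)

ℕ-identity⇒ℤ : ∀ A T B → 4 * A ≡ T + 2 * B → + T ≡ (+ 4 *ℤ + A) -ℤ (+ 2 *ℤ + B)
ℕ-identity⇒ℤ A T B eq = begin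
  + T                                    ≡⟨ lemma (+ T) (+ 2 *ℤ + B) ⟩
  (+ T ℤ.+ + 2 *ℤ + B) -ℤ (+ 2 *ℤ + B)   ≡⟨ cong (λ x → (+ T ℤ.+ x) -ℤ (+ 2 *ℤ + B)) (sym (ℤ.pos-* 2 B)) ⟩
  + (T + 2 * B) -ℤ (+ 2 *ℤ + B)          ≡⟨ cong (λ x → x -ℤ (+ 2 *ℤ + B)) (trans (cong +_ (sym eq)) (ℤ.pos-* 4 A)) ⟩
  (+ 4 *ℤ + A) -ℤ (+ 2 *ℤ + B)           ∎
  where open ≡-Reasoning
        lemma : ∀ t b → t ≡ t ℤ.+ b -ℤ b
        lemma = solve-∀

theorem5p16 : (n : ℕ) → n ≥ 1 →
    ((T A B : ℕ) → t≡ 1 1 1 7 n T → N≡ 1 1 1 7 (4 * n + 5) A → N≡ 1 1 1 7 (8 * n + 10) B →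
    + T ≡ (+ 4 *ℤ + A) -ℤ (+ 2 *ℤ + B))
    × ((T A B : ℕ) → t≡ 1 7 7 7 n T → N≡ 1 7 7 7 (4 * n + 11) A → N≡ 1 7 7 7 (8 * n + 22) B →
    + T ≡ (+ 4 *ℤ + A) -ℤ (+ 2 *ℤ + B))
theorem5p16 n _ =
  (λ T A B t-card A-card B-card →
     ℕ-identity⇒ℤ A T B (four-N≡t+two-N splitting₁ local₁ n (4 * n + 5) (lemma₁ n) A-card t-card B-card)) ,
  (λ T A B t-card A-card B-card →
     ℕ-identity⇒ℤ A T B (four-N≡t+two-N splitting₂ local₂ n (4 * n + 11) (lemma₂ n) A-card t-card B-card))
  where
  lemma₁ : ∀ n → 8 * n + 10 ≡ 2 * (4 * n + 5)
  lemma₁ = ℕ-Solver.solve-∀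
  lemma₂ : ∀ n → 8 * n + 22 ≡ 2 * (4 * n + 11)
  lemma₂ = ℕ-Solver.solve-∀
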